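{- Let $\mathcal{G}$ be a GPCR game with state set $S$ and let $w_n$ be the recursion defined in the context. For each $N\in\mathbb{N}$ there exists an optimal finite horizon strategy $\sigma_N^*$ for the cops with horizon $N$ (i.e. optimal in $\mathcal{G}_N$) such that for all $s\in S$ and all $N_1\le N_2\le N$, if $w_{N_1}(s)=w_{N_2}(s)$ then $\sigma_N^*(s,N_1)=\sigma_N^*(s,N_2)$. The analogous statement holds for the robbers.
   Context: A GPCR game $\mathcal{G}=(S,i_0,F,A,T_{\mathrm{cop}},T_{\mathrm{rob}})$: $S$ non-empty finite set of states, $i_0\in S$ initial state, $F\subseteq S$ final states, $A=A_{\mathrm{cop}}\cup A_{\mathrm{rob}}$ non-empty finite action sets; $T_{\mathrm{cop}}:S\times A_{\mathrm{cop}}\times S\to[0,1]$ with $\sum_{s'}T_{\mathrm{cop}}(s,a,s')\in\{0,1\}$, $A_{\mathrm{cop}}(s)$ (non-empty) the set of playable actions (sum $=1$), and $T_{\mathrm{cop}}(s,a,s)=1$ for $s\in F$; $T_{\mathrm{rob}}$, $A_{\mathrm{rob}}(s)$ analogous. Plays alternate a cop move (choose $a\in A_{\mathrm{cop}}(s)$, next state drawn from $T_{\mathrm{cop}}(s,a,\cdot)$) and a robber move (analogously); a pair of moves is a turn; the cops win iff a state of $F$ is reached. $\mathcal{G}_n$ is the game with $n$ turns. A finite horizon strategy is a map $\sigma:S\times\mathbb{N}\to A$ whose second argument is the number of remaining turns: in $\mathcal{G}_n$, at turn $t=0,1,\dots$ the player in state $s$ plays $\sigma(s,n-t)$. The recursion: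 $w_0(s)=1$ if $s\in F$, $0$ otherwise; for $n\ge1$, $w_n(s)=1$ if $s\in F$, else $w_n(s)=\max_{a\in A_{\mathrm{cop}}(s)}\sum_{s'}T_{\mathrm{cop}}(s,a,s')\min_{a'\in A_{\mathrm{rob}}(s')}\sum_{s''}T_{\mathrm{rob}}(s',a',s'')w_{n-1}(s'')$; $w_n(s)$ is the value of $\mathcal{G}_n$ started at $s$. -}

module Defs where

open import Level using (Level; _⊔_) renaming (suc to lsuc)
open import Data.Nat using (ℕ; zero; suc)
open import Data.Fin using (Fin)
import Data.Fin as Fin
open import Data.Bool using (Bool; true; false; if_then_else_)
open import Data.List using (List; []; _∷_; filter; allFin)
open import Data.Product using (_×_; ∃)
open import Data.Sum using (_⊎_)
open import Relation.Nullary using (yes; no)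
open import Relation.Binary.PropositionalEquality using (_≡_)
open import Relation.Binary.Structures using (IsDecTotalOrder)
open import Algebra.Structures using (IsCommutativeRing)

-- Ordered commutative rings: the scalar domain for probabilities.
-- (agda-stdlib has no reals; ℝ is an instance of this structure.)

record OrderedCommRing (c ℓ : Level) : Set (lsuc (c ⊔ ℓ)) where
  infix  4 _≈_ _≤_
  infixl 6 _+_
  infixl 7 _*_
  field
    Carrier : Set c
    _≈_     : Carrier → Carrier → Set ℓ
    _≤_     : Carrier → Carrier → Set ℓ
    _+_     : Carrier → Carrier → Carrier
    _*_     : Carrier → Carrier → Carrier
    -_      : Carrier → Carrier
    0#      : Carrier
    1#      : Carrier
    isCommutativeRing : IsCommutativeRing _≈_ _+_ _*_ -_ 0# 1#
    isDecTotalOrder   : IsDecTotalOrder _≈_ _≤_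
    +-monoˡ-≤         : ∀ {x y} z → x ≤ y → x + z ≤ y + z
    *-nonNeg          : ∀ {x y} → 0# ≤ x → 0# ≤ y → 0# ≤ x * y

  open IsDecTotalOrder isDecTotalOrder public using (_≤?_; _≟_)

  _⊔ʳ_ : Carrier → Carrier → Carrier
  x ⊔ʳ y with x ≤? y
  ... | yes _ = y
  ... | no  _ = x

  _⊓ʳ_ : Carrier → Carrier → Carrier
  x ⊓ʳ y with x ≤? y
  ... | yes _ = x
  ... | no  _ = y

  -- maximum / minimum of a list (default 0# on the empty list, which
  -- never occurs below since the playable action sets are non-empty)
  maxL : List Carrier → Carrier
  maxL []           = 0#
  maxL (x ∷ [])     = x
  maxL (x ∷ y ∷ xs) = x ⊔ʳ maxL (y ∷ xs)

  minL : List Carrier → Carrier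
  minL []           = 0#
  minL (x ∷ [])     = x
  minL (x ∷ y ∷ xs) = x ⊓ʳ minL (y ∷ xs)

  ∑ : ∀ {n} → (Fin n → Carrier) → Carrier
  ∑ {zero}  f = 0#
  ∑ {suc n} f = f Fin.zero + ∑ (λ i → f (Fin.suc i))

record GPCR {c ℓ} (R : OrderedCommRing c ℓ) : Set (c ⊔ ℓ) where
  open OrderedCommRing R
  field
    nS   : ℕ
    i₀   : Fin nS
    F    : Fin nS → Bool
    nCop : ℕ
    nRob : ℕ
    Tcop : Fin nS → Fin nCop → Fin nS → Carrier
    Trob : Fin nS → Fin nRob → Fin nS → Carrier
    Tcop-range    : ∀ s a s' → (0# ≤ Tcop s a s') × (Tcop s a s' ≤ 1#)
    Trob-range    : ∀ s a s' → (0# ≤ Trob s a s') × (Trob s a s' ≤ 1#)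
    Tcop-sum      : ∀ s a → (∑ (Tcop s a) ≈ 0#) ⊎ (∑ (Tcop s a) ≈ 1#)
    Trob-sum      : ∀ s a → (∑ (Trob s a) ≈ 0#) ⊎ (∑ (Trob s a) ≈ 1#)
    Acop-nonempty : ∀ s → ∃ λ a → ∑ (Tcop s a) ≈ 1#
    Arob-nonempty : ∀ s → ∃ λ a → ∑ (Trob s a) ≈ 1#
    Tcop-final    : ∀ s → F s ≡ true → ∀ a → Tcop s a s ≈ 1#
    Trob-final    : ∀ s → F s ≡ true → ∀ a → Trob s a s ≈ 1#

module Game {c ℓ} {R : OrderedCommRing c ℓ} (G : GPCR R) where
  open OrderedCommRing R
  open GPCR G

  S : Set
  S = Fin nS

  PlayableCop : S → Fin nCop → Set ℓ
  PlayableCop s a = ∑ (Tcop s a) ≈ 1#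

  PlayableRob : S → Fin nRob → Set ℓ
  PlayableRob s a = ∑ (Trob s a) ≈ 1#

  Acop : S → List (Fin nCop)
  Acop s = filter (λ a → ∑ (Tcop s a) ≟ 1#) (allFin nCop)

  Arob : S → List (Fin nRob)
  Arob s = filter (λ a → ∑ (Trob s a) ≟ 1#) (allFin nRob)

  maxCop : S → (Fin nCop → Carrier) → Carrier
  maxCop s f = maxL (Data.List.map f (Acop s))

  minRob : S → (Fin nRob → Carrier) → Carrier
  minRob s f = minL (Data.List.map f (Arob s))

  w : ℕ → S → Carrier
  w zero    s = if F s then 1# else 0#
  w (suc n) s = if F s then 1# else
    maxCop s (λ a → ∑ (λ s' → Tcop s a s' *
      minRob s' (λ a' → ∑ (λ s'' → Trob s' a' s'' * w n s''))))

  -- robber-side value: robber to move at s with n remaining turns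
  -- (including the current one); r_0 = w_0.
  r : ℕ → S → Carrier
  r zero    s = w zero s
  r (suc n) s = if F s then 1# else
    minRob s (λ a' → ∑ (λ s'' → Trob s a' s'' * w n s''))

  -- finite horizon strategies (second argument = remaining turns)
  CopStrategy : Set
  CopStrategy = S → ℕ → Fin nCop

  RobStrategy : Set
  RobStrategy = S → ℕ → Fin nRob

  LegalCop : CopStrategy → Set ℓ
  LegalCop σ = ∀ s k → PlayableCop s (σ s k)

  LegalRob : RobStrategy → Set ℓ
  LegalRob τ = ∀ s k → PlayableRob s (τ s k)

  -- probability that the cops win G_n from s when cops play σ, robbers τ
  val : CopStrategy → RobStrategy → ℕ → S → Carrier
  val σ τ zero    s = if F s then 1# else 0#
  val σ τ (suc n) s = if F s then 1# else
    ∑ (λ s' → Tcop s (σ s (suc n)) s' *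
      ∑ (λ s'' → Trob s' (τ s' (suc n)) s'' * val σ τ n s''))

  OptimalCop : ℕ → CopStrategy → Set ℓ
  OptimalCop N σ = LegalCop σ × (∀ τ → LegalRob τ → ∀ s → w N s ≤ val σ τ N s)

  OptimalRob : ℕ → RobStrategy → Set ℓ
  OptimalRob N τ = LegalRob τ × (∀ σ → LegalCop σ → ∀ s → val σ τ N s ≤ w N s)

-- The values w n s and r n s are monotone in the horizon n, so equal values
-- at horizons N₁ ≤ N₂ mean the value is constant on the "plateau" [N₁, N₂].
-- A strategy is therefore consistent as soon as its move at horizon k
-- depends on k only through a canonical representative of k's plateau:
--   * the cops play an action maximising the one-turn look-ahead of
--     w (pred j), j the FIRST horizon of the plateau; it stays optimal at k
--     because w (pred j) ≤ w (k - 1) and its maximal look-ahead is ≥ w j ≥ w k;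
--   * the robbers (k ≤ N) minimise the look-ahead of w (pred l), l the LAST
--     horizon ≤ N of the plateau; this is the mirror argument, via r l ≤ r k.
module Submission where

open import Defs
open import Level using (Level)
open import Data.Nat using (ℕ; _≤_)
open import Data.Product using (_×_; ∃)
open import Relation.Binary.PropositionalEquality using (_≡_)

open import Data.Nat using (zero; suc; pred; _∸_; z≤n; s≤s; _≤′_; ≤′-reflexive; ≤′-step)
open import Data.Nat.Properties as ℕₚ using (≤⇒≤′; ∸-monoʳ-≤; m∸[m∸n]≡n; n≤1+n)
open import Data.Fin using (Fin)
import Data.Fin as Fin
open import Data.Bool using (true; false)
open import Data.List using ([]; _∷_; map; allFin)
open import Data.List.Relation.Unary.Any using (here; there)
open import Data.List.Membership.Propositional using (_∈_)
open import Data.List.Membership.Propositional.Properties using (∈-filter⁺; ∈-filter⁻; ∈-allFin)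
open import Data.Product using (_,_; proj₁; proj₂)
open import Data.Sum using (_⊎_; inj₁; inj₂)
open import Data.Empty using (⊥-elim)
open import Function using (flip)
open import Relation.Nullary using (yes; no)
open import Relation.Binary.Core using (Rel)
open import Relation.Binary.Definitions using (Decidable)
open import Relation.Binary.PropositionalEquality using (refl; sym; cong; subst)
open import Relation.Binary.Bundles using (Poset)
open import Relation.Binary.Structures using (IsDecTotalOrder)
open import Algebra.Structures using (IsCommutativeRing)
open import Algebra.Bundles using (Ring)
import Algebra.Properties.Ring as RingProperties
import Relation.Binary.Reasoning.PartialOrder as PosetReasoning

module OrderedRingFacts {c ℓ} (R : OrderedCommRing c ℓ) where
  open OrderedCommRing R renaming (_≤_ to _≼_)
  module CR = IsCommutativeRing isCommutativeRing
  module DT = IsDecTotalOrder isDecTotalOrder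
  open DT public using () renaming
    (refl to ≼-refl; trans to ≼-trans; reflexive to ≈⇒≼; antisym to ≼-antisym; total to ≼-total)

  poset : Poset c ℓ ℓ
  poset = record { isPartialOrder = DT.isPartialOrder }

  open PosetReasoning poset

  +-mono : ∀ {a a' b b'} → a ≼ a' → b ≼ b' → a + b ≼ a' + b'
  +-mono {a} {a'} {b} {b'} a≼a' b≼b' = begin
    a + b   ≤⟨ +-monoˡ-≤ b a≼a' ⟩
    a' + b  ≈⟨ CR.+-comm a' b ⟩
    b + a'  ≤⟨ +-monoˡ-≤ a' b≼b' ⟩
    b' + a' ≈⟨ CR.+-comm b' a' ⟩
    a' + b' ∎

  -- multiplication by a non-negative element is monotone:
  -- a * y - a * x = a * (y - x) is a product of non-negative elements
  *-monoˡ : ∀ {a x y} → 0# ≼ a → x ≼ y → a * x ≼ a * y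
  *-monoˡ {a} {x} {y} 0≼a x≼y = begin
    a * x                 ≈⟨ CR.+-identityˡ (a * x) ⟨
    0# + a * x            ≤⟨ +-monoˡ-≤ (a * x) (*-nonNeg 0≼a 0≼y-x) ⟩
    a * (y + - x) + a * x ≈⟨ CR.distribˡ a (y + - x) x ⟨
    a * (y + - x + x)     ≈⟨ CR.*-cong CR.refl y-x+x≈y ⟩
    a * y                 ∎
    where
    0≼y-x : 0# ≼ y + - x
    0≼y-x = begin
      0#      ≈⟨ CR.-‿inverseʳ x ⟨
      x + - x ≤⟨ +-monoˡ-≤ (- x) x≼y ⟩
      y + - x ∎
    y-x+x≈y : y + - x + x ≈ y
    y-x+x≈y = CR.trans (CR.+-assoc y (- x) x)
                (CR.trans (CR.+-cong CR.refl (CR.-‿inverseˡ x)) (CR.+-identityʳ y))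

  -- if 1 ≤ 0 then 0 ≤ -1, hence 0 ≤ (-1) * (-1) = 1
  0≼1 : 0# ≼ 1#
  0≼1 with ≼-total 0# 1#
  ... | inj₁ 0≼1 = 0≼1
  ... | inj₂ 1≼0 = begin
    0#          ≤⟨ *-nonNeg 0≼-1 0≼-1 ⟩
    - 1# * - 1# ≈⟨ RP.-1*x≈-x (- 1#) ⟩
    - - 1#      ≈⟨ RP.-‿involutive 1# ⟩
    1#          ∎
    where
    ring : Ring c ℓ
    ring = record { isRing = CR.isRing }
    module RP = RingProperties ring
    0≼-1 : 0# ≼ - 1#
    0≼-1 = begin
      0#        ≈⟨ CR.-‿inverseʳ 1# ⟨
      1# + - 1# ≤⟨ +-monoˡ-≤ (- 1#) 1≼0 ⟩
      0# + - 1# ≈⟨ CR.+-identityˡ (- 1#) ⟩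
      - 1#      ∎

  ∑-mono : ∀ {n} {f g : Fin n → Carrier} → (∀ i → f i ≼ g i) → ∑ f ≼ ∑ g
  ∑-mono {zero}  f≼g = ≼-refl
  ∑-mono {suc n} f≼g = +-mono (f≼g Fin.zero) (∑-mono (λ i → f≼g (Fin.suc i)))

  ∑-cong : ∀ {n} {f g : Fin n → Carrier} → (∀ i → f i ≈ g i) → ∑ f ≈ ∑ g
  ∑-cong {zero}  f≈g = CR.refl
  ∑-cong {suc n} f≈g = CR.+-cong (f≈g Fin.zero) (∑-cong (λ i → f≈g (Fin.suc i)))

  ∑-nonneg : ∀ {n} {f : Fin n → Carrier} → (∀ i → 0# ≼ f i) → 0# ≼ ∑ f
  ∑-nonneg {zero}  0≼f = ≼-refl
  ∑-nonneg {suc n} 0≼f =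
    ≼-trans (≈⇒≼ (CR.sym (CR.+-identityˡ 0#)))
            (+-mono (0≼f Fin.zero) (∑-nonneg (λ i → 0≼f (Fin.suc i))))

  ∑-term : ∀ {n} {f : Fin n → Carrier} → (∀ i → 0# ≼ f i) → ∀ i → f i ≼ ∑ f
  ∑-term {suc n} {f} 0≼f Fin.zero = begin
    f Fin.zero      ≈⟨ CR.+-identityʳ (f Fin.zero) ⟨
    f Fin.zero + 0# ≤⟨ +-mono ≼-refl (∑-nonneg (λ i → 0≼f (Fin.suc i))) ⟩
    ∑ f             ∎
  ∑-term {suc n} {f} 0≼f (Fin.suc i) = begin
    f (Fin.suc i)                ≤⟨ ∑-term (λ j → 0≼f (Fin.suc j)) i ⟩
    ∑ (λ j → f (Fin.suc j))      ≈⟨ CR.+-identityˡ _ ⟨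
    0# + ∑ (λ j → f (Fin.suc j)) ≤⟨ +-mono (0≼f Fin.zero) ≼-refl ⟩
    ∑ f                          ∎

  weighted : ∀ {n} → (Fin n → Carrier) → (Fin n → Carrier) → Carrier
  weighted T f = ∑ (λ x → T x * f x)

  module _ {n} {T : Fin n → Carrier} (0≼T : ∀ x → 0# ≼ T x) where

    weighted-mono : ∀ {f g} → (∀ x → f x ≼ g x) → weighted T f ≼ weighted T g
    weighted-mono f≼g = ∑-mono (λ x → *-monoˡ (0≼T x) (f≼g x))

    weighted-nonneg : ∀ {f} → (∀ x → 0# ≼ f x) → 0# ≼ weighted T f
    weighted-nonneg 0≼f = ∑-nonneg (λ x → *-nonNeg (0≼T x) (0≼f x))

    weighted-term : ∀ {f} → (∀ x → 0# ≼ f x) → ∀ x → T x * f x ≼ weighted T f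
    weighted-term 0≼f = ∑-term (λ x → *-nonNeg (0≼T x) (0≼f x))

    weighted-≤1 : ∀ {f} → (∀ x → f x ≼ 1#) → ∑ T ≈ 1# → weighted T f ≼ 1#
    weighted-≤1 {f} f≼1 ∑T≈1 = begin
      weighted T f          ≤⟨ weighted-mono f≼1 ⟩
      ∑ (λ x → T x * 1#)    ≈⟨ ∑-cong (λ x → CR.*-identityʳ (T x)) ⟩
      ∑ T                   ≈⟨ ∑T≈1 ⟩
      1#                    ∎

module Extrema {c ℓ} (R : OrderedCommRing c ℓ) where
  open OrderedCommRing R renaming (_≤_ to _≼_)
  open OrderedRingFacts R using (≼-refl; ≼-trans; ≼-total)

  ⊔-l : ∀ {x y} → x ≼ x ⊔ʳ y
  ⊔-l {x} {y} with x ≤? y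
  ... | yes x≼y = x≼y
  ... | no  _   = ≼-refl

  ⊔-r : ∀ {x y} → y ≼ x ⊔ʳ y
  ⊔-r {x} {y} with x ≤? y | ≼-total x y
  ... | yes _   | _       = ≼-refl
  ... | no  x⋠y | inj₁ x≼y = ⊥-elim (x⋠y x≼y)
  ... | no  _   | inj₂ y≼x = y≼x

  ⊓-l : ∀ {x y} → x ⊓ʳ y ≼ x
  ⊓-l {x} {y} with x ≤? y | ≼-total x y
  ... | yes _   | _       = ≼-refl
  ... | no  x⋠y | inj₁ x≼y = ⊥-elim (x⋠y x≼y)
  ... | no  _   | inj₂ y≼x = y≼x

  ⊓-r : ∀ {x y} → x ⊓ʳ y ≼ y
  ⊓-r {x} {y} with x ≤? y
  ... | yes x≼y = x≼y
  ... | no  _   = ≼-refl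

  module _ {A : Set} (f : A → Carrier) where

    maxL-upper : ∀ {a} l → a ∈ l → f a ≼ maxL (map f l)
    maxL-upper (x ∷ [])     (here refl) = ≼-refl
    maxL-upper (x ∷ y ∷ xs) (here refl) = ⊔-l
    maxL-upper (x ∷ y ∷ xs) (there a∈) = ≼-trans (maxL-upper (y ∷ xs) a∈) ⊔-r

    minL-lower : ∀ {a} l → a ∈ l → minL (map f l) ≼ f a
    minL-lower (x ∷ [])     (here refl) = ≼-refl
    minL-lower (x ∷ y ∷ xs) (here refl) = ⊓-l
    minL-lower (x ∷ y ∷ xs) (there a∈) = ≼-trans ⊓-r (minL-lower (y ∷ xs) a∈)

    maxL-attained : ∀ {a} l → a ∈ l → ∃ λ b → b ∈ l × maxL (map f l) ≡ f b
    maxL-attained (x ∷ []) _ = x , here refl , refl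
    maxL-attained (x ∷ y ∷ xs) _ with f x ≤? maxL (map f (y ∷ xs)) | maxL-attained (y ∷ xs) (here refl)
    ... | yes _ | b , b∈ , eq = b , there b∈ , eq
    ... | no  _ | _           = x , here refl , refl

    minL-attained : ∀ {a} l → a ∈ l → ∃ λ b → b ∈ l × minL (map f l) ≡ f b
    minL-attained (x ∷ []) _ = x , here refl , refl
    minL-attained (x ∷ y ∷ xs) _ with f x ≤? minL (map f (y ∷ xs)) | minL-attained (y ∷ xs) (here refl)
    ... | yes _ | _           = x , here refl , refl
    ... | no  _ | b , b∈ , eq = b , there b∈ , eq

    maxL-lub : ∀ {a u} l → a ∈ l → (∀ b → b ∈ l → f b ≼ u) → maxL (map f l) ≼ u
    maxL-lub l a∈ f≼u with maxL-attained l a∈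
    ... | b , b∈ , eq rewrite eq = f≼u b b∈

    minL-glb : ∀ {a u} l → a ∈ l → (∀ b → b ∈ l → u ≼ f b) → u ≼ minL (map f l)
    minL-glb l a∈ u≼f with minL-attained l a∈
    ... | b , b∈ , eq rewrite eq = u≼f b b∈

  maxL-mono : ∀ {A : Set} {f g : A → Carrier} → (∀ a → f a ≼ g a) → ∀ l → maxL (map f l) ≼ maxL (map g l)
  maxL-mono f≼g []       = ≼-refl
  maxL-mono {f = f} {g} f≼g l@(_ ∷ _) =
    maxL-lub f l (here refl) (λ b b∈ → ≼-trans (f≼g b) (maxL-upper g l b∈))

  minL-mono : ∀ {A : Set} {f g : A → Carrier} → (∀ a → f a ≼ g a) → ∀ l → minL (map f l) ≼ minL (map g l)
  minL-mono f≼g []       = ≼-refl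
  minL-mono {f = f} {g} f≼g l@(_ ∷ _) =
    minL-glb g l (here refl) (λ b b∈ → ≼-trans (minL-lower f l b∈) (f≼g b))

-- Canonical representatives of plateaus of a monotone sequence f : ℕ → A
-- in a decidable preorder: first k is the earliest index j ≤ k with
-- f k ≼ f j, and it is the same for all indices of a plateau.
module Plateau {a ℓ} {A : Set a} (_≼_ : Rel A ℓ)
    (≼-refl : ∀ {x} → x ≼ x) (≼-trans : ∀ {x y z} → x ≼ y → y ≼ z → x ≼ z)
    (_≼?_ : Decidable _≼_)
    (f : ℕ → A) (f-step : ∀ n → f n ≼ f (suc n)) where

  monotone : ∀ {m n} → m ≤ n → f m ≼ f n
  monotone m≤n = go (≤⇒≤′ m≤n)
    where
    go : ∀ {m n} → m ≤′ n → f m ≼ f n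
    go (≤′-reflexive refl) = ≼-refl
    go (≤′-step m≤′n)      = ≼-trans (go m≤′n) (f-step _)

  first : ℕ → ℕ
  first zero = zero
  first (suc k) with f (suc k) ≼? f k
  ... | yes _ = first k
  ... | no  _ = suc k

  first-≤ : ∀ k → first k ≤ k
  first-≤ zero = z≤n
  first-≤ (suc k) with f (suc k) ≼? f k
  ... | yes _ = ℕₚ.m≤n⇒m≤1+n (first-≤ k)
  ... | no  _ = ℕₚ.≤-refl

  first-reach : ∀ k → f k ≼ f (first k)
  first-reach zero = ≼-refl
  first-reach (suc k) with f (suc k) ≼? f k
  ... | yes fk+1≼fk = ≼-trans fk+1≼fk (first-reach k)
  ... | no  _       = ≼-refl

  -- if f k₂ ≼ f k₁ for k₁ ≤ k₂, then f is constant on [k₁, k₂] up to ≼,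
  -- and the scan defining first never stops strictly above k₁
  first-plateau : ∀ {k₁ k₂} → k₁ ≤ k₂ → f k₂ ≼ f k₁ → first k₂ ≡ first k₁
  first-plateau k₁≤k₂ = go (≤⇒≤′ k₁≤k₂)
    where
    go : ∀ {k₁ k₂} → k₁ ≤′ k₂ → f k₂ ≼ f k₁ → first k₂ ≡ first k₁
    go (≤′-reflexive refl) _ = refl
    go {k₁} {suc k} (≤′-step k₁≤′k) fk+1≼fk₁ with f (suc k) ≼? f k
    ... | yes _ = go k₁≤′k (≼-trans (f-step k) fk+1≼fk₁)
    ... | no  fk+1⋠fk = ⊥-elim (fk+1⋠fk (≼-trans fk+1≼fk₁ (monotone (ℕₚ.≤′⇒≤ k₁≤′k))))

-- The mirror image: last B k is the latest index l with k ≤ l ≤ B and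
-- f l ≼ f k.  It is obtained from first applied to the reversed sequence
-- i ↦ f (B ∸ i), which is monotone for the reversed preorder.
module BackwardPlateau {a ℓ} {A : Set a} (_≼_ : Rel A ℓ)
    (≼-refl : ∀ {x} → x ≼ x) (≼-trans : ∀ {x y z} → x ≼ y → y ≼ z → x ≼ z)
    (_≼?_ : Decidable _≼_)
    (f : ℕ → A) (f-step : ∀ n → f n ≼ f (suc n)) (B : ℕ) where

  open Plateau _≼_ ≼-refl ≼-trans _≼?_ f f-step using (monotone)
  private
    module Reversed = Plateau (flip _≼_) ≼-refl (flip ≼-trans) (flip _≼?_)
      (λ i → f (B ∸ i)) (λ i → monotone (∸-monoʳ-≤ B (n≤1+n i)))

  last : ℕ → ℕ
  last k = B ∸ Reversed.first (B ∸ k)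

  last-≥ : ∀ {k} → k ≤ B → k ≤ last k
  last-≥ {k} k≤B = subst (_≤ last k) (m∸[m∸n]≡n k≤B) (∸-monoʳ-≤ B (Reversed.first-≤ (B ∸ k)))

  last-reach : ∀ {k} → k ≤ B → f (last k) ≼ f k
  last-reach {k} k≤B = subst (λ j → f (last k) ≼ f j) (m∸[m∸n]≡n k≤B) (Reversed.first-reach (B ∸ k))

  last-plateau : ∀ {k₁ k₂} → k₁ ≤ k₂ → k₂ ≤ B → f k₂ ≼ f k₁ → last k₁ ≡ last k₂
  last-plateau {k₁} {k₂} k₁≤k₂ k₂≤B fk₂≼fk₁ =
    cong (λ j → B ∸ j) (Reversed.first-plateau (∸-monoʳ-≤ B k₁≤k₂) reversed)
    where
    reversed : f (B ∸ (B ∸ k₂)) ≼ f (B ∸ (B ∸ k₁))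
    reversed rewrite m∸[m∸n]≡n k₂≤B | m∸[m∸n]≡n (ℕₚ.≤-trans k₁≤k₂ k₂≤B) = fk₂≼fk₁

module Values {c ℓ} {R : OrderedCommRing c ℓ} (G : GPCR R) where
  open OrderedCommRing R renaming (_≤_ to _≼_)
  open GPCR G
  open Game G
  open OrderedRingFacts R
  open Extrema R

  Tcop-nonneg : ∀ s a s' → 0# ≼ Tcop s a s'
  Tcop-nonneg s a s' = proj₁ (Tcop-range s a s')

  Trob-nonneg : ∀ s a s' → 0# ≼ Trob s a s'
  Trob-nonneg s a s' = proj₁ (Trob-range s a s')

  playable⇒∈Acop : ∀ {s a} → PlayableCop s a → a ∈ Acop s
  playable⇒∈Acop {s} {a} = ∈-filter⁺ (λ a → ∑ (Tcop s a) ≟ 1#) (∈-allFin a)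

  playable⇒∈Arob : ∀ {s a} → PlayableRob s a → a ∈ Arob s
  playable⇒∈Arob {s} {a} = ∈-filter⁺ (λ a → ∑ (Trob s a) ≟ 1#) (∈-allFin a)

  ∈Acop⇒playable : ∀ {s a} → a ∈ Acop s → PlayableCop s a
  ∈Acop⇒playable {s} a∈ = proj₂ (∈-filter⁻ (λ a → ∑ (Tcop s a) ≟ 1#) {xs = allFin nCop} a∈)

  ∈Arob⇒playable : ∀ {s a} → a ∈ Arob s → PlayableRob s a
  ∈Arob⇒playable {s} a∈ = proj₂ (∈-filter⁻ (λ a → ∑ (Trob s a) ≟ 1#) {xs = allFin nRob} a∈)

  someCop : ∀ s → proj₁ (Acop-nonempty s) ∈ Acop s
  someCop s = playable⇒∈Acop (proj₂ (Acop-nonempty s))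

  someRob : ∀ s → proj₁ (Arob-nonempty s) ∈ Arob s
  someRob s = playable⇒∈Arob (proj₂ (Arob-nonempty s))

  robStep : (S → Carrier) → S → Fin nRob → Carrier
  robStep v s a = weighted (Trob s a) v

  copStep : (S → Carrier) → S → Fin nCop → Carrier
  copStep v s a = weighted (Tcop s a) (λ s' → minRob s' (robStep v s'))

  UnitValued : (S → Carrier) → Set ℓ
  UnitValued v = ∀ s → 0# ≼ v s × v s ≼ 1#

  copStep-mono : ∀ {v v'} → (∀ s → v s ≼ v' s) → ∀ s a → copStep v s a ≼ copStep v' s a
  copStep-mono v≼v' s a = weighted-mono (Tcop-nonneg s a)
    (λ s' → minL-mono (λ a' → weighted-mono (Trob-nonneg s' a') v≼v') (Arob s'))

  minRobStep-unit : ∀ {v} → UnitValued v → UnitValued (λ s → minRob s (robStep v s))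
  minRobStep-unit v∈[0,1] s =
    minL-glb (robStep _ s) (Arob s) (someRob s)
      (λ a _ → weighted-nonneg (Trob-nonneg s a) (λ s' → proj₁ (v∈[0,1] s'))) ,
    ≼-trans (minL-lower (robStep _ s) (Arob s) (someRob s))
      (weighted-≤1 (Trob-nonneg s _) (λ s' → proj₂ (v∈[0,1] s')) (proj₂ (Arob-nonempty s)))

  copStep-unit : ∀ {v} → UnitValued v → ∀ s {a} → PlayableCop s a →
    0# ≼ copStep v s a × copStep v s a ≼ 1#
  copStep-unit v∈[0,1] s {a} playable =
    weighted-nonneg (Tcop-nonneg s a) (λ s' → proj₁ (minRobStep-unit v∈[0,1] s')) ,
    weighted-≤1 (Tcop-nonneg s a) (λ s' → proj₂ (minRobStep-unit v∈[0,1] s')) playable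

  w-unit : ∀ n → UnitValued (w n)
  w-unit zero s with F s
  ... | true  = 0≼1 , ≼-refl
  ... | false = ≼-refl , 0≼1
  w-unit (suc n) s with F s
  ... | true  = 0≼1 , ≼-refl
  ... | false =
    ≼-trans (proj₁ (copStep-unit (w-unit n) s (proj₂ (Acop-nonempty s))))
            (maxL-upper (copStep (w n) s) (Acop s) (someCop s)) ,
    maxL-lub (copStep (w n) s) (Acop s) (someCop s)
      (λ a a∈ → proj₂ (copStep-unit (w-unit n) s (∈Acop⇒playable a∈)))

  w-final : ∀ {s} n → F s ≡ true → w n s ≡ 1#
  w-final zero    F≡true rewrite F≡true = refl
  w-final (suc n) F≡true rewrite F≡true = refl

  final-or-not : ∀ s → F s ≡ true ⊎ F s ≡ false
  final-or-not s with F s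
  ... | true  = inj₁ refl
  ... | false = inj₂ refl

  w-unfold : ∀ {s} n → F s ≡ false → w (suc n) s ≡ maxCop s (copStep (w n) s)
  w-unfold n F≡false rewrite F≡false = refl

  expected-move : CopStrategy → RobStrategy → ℕ → S → Carrier
  expected-move σ τ m s = weighted (Tcop s (σ s (suc m))) (λ s' → robStep (val σ τ m) s' (τ s' (suc m)))

  val-step : ∀ σ τ {s} m → F s ≡ false → val σ τ (suc m) s ≡ expected-move σ τ m s
  val-step σ τ m F≡false rewrite F≡false = refl

  val-final : ∀ σ τ {s} n → F s ≡ true → val σ τ n s ≡ 1#
  val-final σ τ zero    F≡true rewrite F≡true = refl
  val-final σ τ (suc n) F≡true rewrite F≡true = refl

  w-step : ∀ n s → w n s ≼ w (suc n) s
  w-step zero s with F s | proj₁ (w-unit 1 s)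
  ... | true  | _     = ≼-refl
  ... | false | 0≼w₁ = 0≼w₁
  w-step (suc n) s with F s
  ... | true  = ≼-refl
  ... | false = maxL-mono (copStep-mono (w-step n) s) (Acop s)

  w-mono : ∀ {m n} → m ≤ n → ∀ s → w m s ≼ w n s
  w-mono m≤n s = Plateau.monotone _≼_ ≼-refl ≼-trans _≤?_ (λ n → w n s) (λ n → w-step n s) m≤n

  final-robStep : ∀ {s} n → F s ≡ true → ∀ a → 1# ≼ robStep (w n) s a
  final-robStep {s} n F≡true a = ≼-trans (≈⇒≼ 1≈T*w)
    (weighted-term (Trob-nonneg s a) (λ s' → proj₁ (w-unit n s')) s)
    where
    1≈T*w : 1# ≈ Trob s a s * w n s
    1≈T*w = CR.trans (CR.sym (CR.*-identityˡ 1#))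
      (CR.*-cong (CR.sym (Trob-final s F≡true a)) (CR.reflexive (sym (w-final n F≡true))))

  -- Bellman equation for the robber's value, also valid at final states
  r-bellman : ∀ n s → r (suc n) s ≈ minRob s (robStep (w n) s)
  r-bellman n s with F s in F≡
  ... | false = CR.refl
  ... | true  = ≼-antisym
    (minL-glb (robStep (w n) s) (Arob s) (someRob s) (λ a _ → final-robStep n F≡ a))
    (proj₂ (minRobStep-unit (w-unit n) s))

  r-step : ∀ n s → r n s ≼ r (suc n) s
  r-step zero s with F s | proj₁ (minRobStep-unit (w-unit 0) s)
  ... | true  | _     = ≼-refl
  ... | false | 0≼r₁ = 0≼r₁
  r-step (suc n) s = begin
    r (suc n) s                      ≈⟨ r-bellman n s ⟩
    minRob s (robStep (w n) s)       ≤⟨ minL-mono (λ a → weighted-mono (Trob-nonneg s a) (w-step n)) (Arob s) ⟩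
    minRob s (robStep (w (suc n)) s) ≈⟨ r-bellman (suc n) s ⟨
    r (suc (suc n)) s                ∎
    where open PosetReasoning poset

module Strategies {c ℓ} {R : OrderedCommRing c ℓ} (G : GPCR R) (N : ℕ) where
  open OrderedCommRing R renaming (_≤_ to _≼_)
  open GPCR G
  open Game G
  open OrderedRingFacts R
  open Extrema R
  open Values G
  open PosetReasoning poset

  ≈⇒≽ : ∀ {x y} → x ≈ y → y ≼ x
  ≈⇒≽ x≈y = ≈⇒≼ (CR.sym x≈y)

  module WPlateau (s : S) = Plateau _≼_ ≼-refl ≼-trans _≤?_ (λ n → w n s) (λ n → w-step n s)
  module RPlateau (s : S) = BackwardPlateau _≼_ ≼-refl ≼-trans _≤?_ (λ n → r n s) (λ n → r-step n s) N

  copChoice : ∀ s k → let v = w (pred (WPlateau.first s k)) in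
    ∃ λ a → a ∈ Acop s × maxCop s (copStep v s) ≡ copStep v s a
  copChoice s k = maxL-attained (copStep (w (pred (WPlateau.first s k))) s) (Acop s) (someCop s)

  σ : CopStrategy
  σ s k = proj₁ (copChoice s k)

  robChoice : ∀ s k → let v = w (pred (RPlateau.last s k)) in
    ∃ λ a → a ∈ Arob s × minRob s (robStep v s) ≡ robStep v s a
  robChoice s k = minL-attained (robStep (w (pred (RPlateau.last s k))) s) (Arob s) (someRob s)

  τ : RobStrategy
  τ s k = proj₁ (robChoice s k)

  -- two facts about the predecessor, needed because horizon k is played
  -- with the look-ahead of w (k - 1)
  j≤suc-pred : ∀ j → j ≤ suc (pred j)
  j≤suc-pred zero    = z≤n
  j≤suc-pred (suc j) = ℕₚ.≤-refl

  suc-pred : ∀ {m l} → suc m ≤ l → suc (pred l) ≡ l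
  suc-pred (s≤s _) = refl

  σ-optimal-move : ∀ m s → F s ≡ false → w (suc m) s ≼ copStep (w m) s (σ s (suc m))
  σ-optimal-move m s F≡false = begin
    w (suc m) s                          ≤⟨ WPlateau.first-reach s (suc m) ⟩
    w j s                                ≤⟨ w-mono (j≤suc-pred j) s ⟩
    w (suc (pred j)) s                   ≡⟨ w-unfold (pred j) F≡false ⟩
    maxCop s (copStep (w (pred j)) s)    ≡⟨ proj₂ (proj₂ (copChoice s (suc m))) ⟩
    copStep (w (pred j)) s (σ s (suc m)) ≤⟨ copStep-mono (w-mono pred-j≤m) s _ ⟩
    copStep (w m) s (σ s (suc m))        ∎
    where
    j : ℕ
    j = WPlateau.first s (suc m)
    pred-j≤m : pred j ≤ m
    pred-j≤m = ℕₚ.pred-mono-≤ (WPlateau.first-≤ s (suc m))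

  τ-optimal-move : ∀ m s → suc m ≤ N → robStep (w m) s (τ s (suc m)) ≼ minRob s (robStep (w m) s)
  τ-optimal-move m s m<N = begin
    robStep (w m) s (τ s (suc m))        ≤⟨ weighted-mono (Trob-nonneg s _) (w-mono m≤pred-l) ⟩
    robStep (w (pred l)) s (τ s (suc m)) ≡⟨ proj₂ (proj₂ (robChoice s (suc m))) ⟨
    minRob s (robStep (w (pred l)) s)    ≈⟨ r-bellman (pred l) s ⟨
    r (suc (pred l)) s                   ≡⟨ cong (λ n → r n s) (suc-pred m<l) ⟩
    r l s                                ≤⟨ RPlateau.last-reach s m<N ⟩
    r (suc m) s                          ≈⟨ r-bellman m s ⟩
    minRob s (robStep (w m) s)           ∎
    where
    l : ℕ
    l = RPlateau.last s (suc m)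
    m<l : suc m ≤ l
    m<l = RPlateau.last-≥ s m<N
    m≤pred-l : m ≤ pred l
    m≤pred-l = ℕₚ.pred-mono-≤ m<l

  σ-legal : LegalCop σ
  σ-legal s k = ∈Acop⇒playable (proj₁ (proj₂ (copChoice s k)))

  τ-legal : LegalRob τ
  τ-legal s k = ∈Arob⇒playable (proj₁ (proj₂ (robChoice s k)))

  σ-optimal : ∀ τ' → LegalRob τ' → ∀ n s → w n s ≼ val σ τ' n s
  σ-optimal τ' τ'-legal zero s = ≼-refl
  σ-optimal τ' τ'-legal (suc m) s with final-or-not s
  ... | inj₁ F≡true = begin
    w (suc m) s        ≡⟨ w-final (suc m) F≡true ⟩
    1#                 ≡⟨ val-final σ τ' (suc m) F≡true ⟨
    val σ τ' (suc m) s ∎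
  ... | inj₂ F≡false = begin
    w (suc m) s                   ≤⟨ σ-optimal-move m s F≡false ⟩
    copStep (w m) s (σ s (suc m)) ≤⟨ weighted-mono (Tcop-nonneg s _) robber-plays-τ' ⟩
    expected-move σ τ' m s        ≡⟨ val-step σ τ' m F≡false ⟨
    val σ τ' (suc m) s            ∎
    where
    robber-plays-τ' : ∀ s' → minRob s' (robStep (w m) s') ≼ robStep (val σ τ' m) s' (τ' s' (suc m))
    robber-plays-τ' s' =
      ≼-trans (minL-lower (robStep (w m) s') (Arob s') (playable⇒∈Arob (τ'-legal s' (suc m))))
              (weighted-mono (Trob-nonneg s' _) (σ-optimal τ' τ'-legal m))

  τ-optimal : ∀ σ' → LegalCop σ' → ∀ n → n ≤ N → ∀ s → val σ' τ n s ≼ w n s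
  τ-optimal σ' σ'-legal zero    _   s = ≼-refl
  τ-optimal σ' σ'-legal (suc m) m<N s with final-or-not s
  ... | inj₁ F≡true = begin
    val σ' τ (suc m) s ≡⟨ val-final σ' τ (suc m) F≡true ⟩
    1#                 ≡⟨ w-final (suc m) F≡true ⟨
    w (suc m) s        ∎
  ... | inj₂ F≡false = begin
    val σ' τ (suc m) s              ≡⟨ val-step σ' τ m F≡false ⟩
    expected-move σ' τ m s          ≤⟨ weighted-mono (Tcop-nonneg s _) robber-plays-τ ⟩
    copStep (w m) s (σ' s (suc m))  ≤⟨ maxL-upper (copStep (w m) s) (Acop s) σ'-move-playable ⟩
    maxCop s (copStep (w m) s)      ≡⟨ w-unfold m F≡false ⟨
    w (suc m) s                     ∎
    where
    σ'-move-playable : σ' s (suc m) ∈ Acop s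
    σ'-move-playable = playable⇒∈Acop (σ'-legal s (suc m))
    robber-plays-τ : ∀ s' → robStep (val σ' τ m) s' (τ s' (suc m)) ≼ minRob s' (robStep (w m) s')
    robber-plays-τ s' =
      ≼-trans (weighted-mono (Trob-nonneg s' _) (τ-optimal σ' σ'-legal m (ℕₚ.<⇒≤ m<N)))
              (τ-optimal-move m s' m<N)

  -- equal values put N₁ and N₂ on one plateau, hence give the same choice
  σ-consistent : ∀ s N₁ N₂ → N₁ ≤ N₂ → w N₁ s ≈ w N₂ s → σ s N₁ ≡ σ s N₂
  σ-consistent s N₁ N₂ N₁≤N₂ w≈ =
    cong (λ j → proj₁ (maxL-attained (copStep (w (pred j)) s) (Acop s) (someCop s)))
      (sym (WPlateau.first-plateau s N₁≤N₂ (≈⇒≽ w≈)))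

  τ-consistent : ∀ s N₁ N₂ → N₁ ≤ N₂ → N₂ ≤ N → r N₁ s ≈ r N₂ s → τ s N₁ ≡ τ s N₂
  τ-consistent s N₁ N₂ N₁≤N₂ N₂≤N r≈ =
    cong (λ l → proj₁ (minL-attained (robStep (w (pred l)) s) (Arob s) (someRob s)))
      (RPlateau.last-plateau s N₁≤N₂ N₂≤N (≈⇒≽ r≈))

proposition1 : ∀ {c ℓ} (R : OrderedCommRing c ℓ) (G : GPCR R) (N : ℕ) →
    (∃ λ σ → Game.OptimalCop G N σ ×
      (∀ s N₁ N₂ → N₁ ≤ N₂ → N₂ ≤ N →
        OrderedCommRing._≈_ R (Game.w G N₁ s) (Game.w G N₂ s) → σ s N₁ ≡ σ s N₂))
    ×
    (∃ λ τ → Game.OptimalRob G N τ ×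
      (∀ s N₁ N₂ → N₁ ≤ N₂ → N₂ ≤ N →
        OrderedCommRing._≈_ R (Game.r G N₁ s) (Game.r G N₂ s) → τ s N₁ ≡ τ s N₂))
proposition1 R G N =
  (σ , (σ-legal , λ τ' τ'-legal → σ-optimal τ' τ'-legal N) ,
       λ s N₁ N₂ N₁≤N₂ _ → σ-consistent s N₁ N₂ N₁≤N₂) ,
  (τ , (τ-legal , λ σ' σ'-legal → τ-optimal σ' σ'-legal N ℕₚ.≤-refl) ,
       τ-consistent)
  where open Strategies G N
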